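{- Let $G$ be a $G$-formula and $\Gamma$ a finite multiset of $D$-formulas. Then $\Gamma\longrightarrow G$ has an $\mathbf{I}_G$-proof only if it has an $\mathbf{O}_G$-proof.
   Context: Formulas are first-order with logical symbols $\top,\bot,\land,\lor,\supset,\exists,\forall$; $\top,\bot$ are not atomic; $[t/x]$ is capture-avoiding substitution. A sequent $\Delta\longrightarrow F$ has a finite multiset $\Delta$ of formulas as antecedent and a single formula $F$ as succedent. For a fixed formula $G$, the $\mathbf{I}_G$-calculus has axioms $\Delta\longrightarrow\top$ and $\Delta\longrightarrow A$ with $A\in\Delta$ and $A$ atomic or $\bot$, and rules: contr-L ($B,B,\Delta\longrightarrow F\Rightarrow B,\Delta\longrightarrow F$); $\bot$-R ($\Delta\longrightarrow\bot\Rightarrow\Delta\longrightarrow F$); $\land$-L ($B,D,B\land D,\Delta\longrightarrow F\Rightarrow B\land D,\Delta\longrightarrow F$); $\land$-R ($\Delta\longrightarrow B$ and $\Delta\longrightarrow D\Rightarrow\Delta\longrightarrow B\land D$); $\lor$-R ($\Delta\longrightarrow B$ or $\Delta\longrightarrow D\Rightarrow\Delta\longrightarrow B\lor D$); $\supset$-L ($B\supset D,\Delta\longrightarrow B$ and $D,\Delta\longrightarrow F\Rightarrow B\supset D,\Delta\longrightarrow F$); $\supset$-R ($B,\Delta\longrightarrow D\Rightarrow\Delta\longrightarrow B\supset D$); $\forall$-L ($[t/x]B,\forall xB,\Delta\longrightarrow F\Rightarrow\forall xB,\Delta\longrightarrow F$); $\exists$-R ($\Delta\longrightarrow[t/x]B\Rightarrow\Delta\longrightarrow\exists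 xB$); $\exists$-L ($[c/x]B,\Delta\longrightarrow F\Rightarrow\exists xB,\Delta\longrightarrow F$) and $\forall$-R ($\Delta\longrightarrow[c/x]B\Rightarrow\Delta\longrightarrow\forall xB$), with the constant $c$ occurring neither in the lower sequent nor in $G$; $\lor$-L$_G$ ($B,\Delta\longrightarrow F$ and $D,\Delta\longrightarrow G\Rightarrow B\lor D,\Delta\longrightarrow F$); and res$_G$ ($\Delta\longrightarrow G\Rightarrow\Delta\longrightarrow F$). (There is no ordinary $\lor$-L rule.) An $\mathbf{I}_G$-proof is a derivation in this calculus. An $\mathbf{O}_G$-proof is an $\mathbf{I}_G$-proof in which every sequent whose succedent formula has top-level symbol among $\land,\lor,\supset,\exists,\forall$ occurs as the lower sequent of the inference rule introducing that top-level symbol. $G$-formulas and $D$-formulas: $G ::= \top \mid \bot \mid A \mid G\land G \mid G\lor G \mid D\supset G \mid \exists x\, G$ and $D ::= \top \mid \bot \mid A \mid G\supset D \mid D\land D \mid D\lor D \mid \exists x\, D \mid \forall x\, D$, $A$ atomic. -}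

module Defs where

open import Data.Nat using (ℕ; zero; suc; _<ᵇ_; _≡ᵇ_)
open import Data.Bool using (Bool; true; false; if_then_else_)
open import Data.List using (List; []; _∷_)
open import Data.List.Relation.Unary.Any using (Any)
open import Data.List.Relation.Unary.All using (All)
open import Data.List.Membership.Propositional using (_∈_)
open import Data.List.Relation.Binary.Permutation.Propositional using (_↭_)
open import Data.Product using (Σ; _×_)
open import Data.Unit using (⊤)
open import Relation.Nullary using (¬_)

-- First-order terms and formulas (de Bruijn indices for bound variables,
-- so capture-avoiding substitution is automatic).
-- Constants ("const c") serve as eigen-constants; function and predicate
-- symbols are named by natural numbers and applied to lists of terms.

data Term : Set where
  var   : ℕ → Term
  const : ℕ → Term
  app   : ℕ → List Term → Term

infixr 6 _∧'_
infixr 5 _∨'_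
infixr 4 _⊃_

data Fm : Set where
  ⊤'    : Fm
  ⊥'    : Fm
  atom  : ℕ → List Term → Fm
  _∧'_  : Fm → Fm → Fm
  _∨'_  : Fm → Fm → Fm
  _⊃_   : Fm → Fm → Fm
  ∃'    : Fm → Fm                  -- ∃x B, x = de Bruijn index 0 in B
  ∀'    : Fm → Fm

mutual
  shiftT : ℕ → Term → Term
  shiftT k (var n) = if n <ᵇ k then var n else var (suc n)
  shiftT k (const c) = const c
  shiftT k (app f ts) = app f (shiftTs k ts)

  shiftTs : ℕ → List Term → List Term
  shiftTs k [] = []
  shiftTs k (t ∷ ts) = shiftT k t ∷ shiftTs k ts

-- substT k s t : replace variable k by s, decrementing variables above k
mutual
  substT : ℕ → Term → Term → Term
  substT k s (var zero) = if k ≡ᵇ zero then s else var zero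
  substT k s (var (suc n)) =
    if n <ᵇ k then (if suc n ≡ᵇ k then s else var (suc n)) else var n
  substT k s (const c) = const c
  substT k s (app f ts) = app f (substTs k s ts)

  substTs : ℕ → Term → List Term → List Term
  substTs k s [] = []
  substTs k s (t ∷ ts) = substT k s t ∷ substTs k s ts

substF : ℕ → Term → Fm → Fm
substF k s ⊤' = ⊤'
substF k s ⊥' = ⊥'
substF k s (atom p ts) = atom p (substTs k s ts)
substF k s (A ∧' B) = substF k s A ∧' substF k s B
substF k s (A ∨' B) = substF k s A ∨' substF k s B
substF k s (A ⊃ B) = substF k s A ⊃ substF k s B
substF k s (∃' B) = ∃' (substF (suc k) (shiftT 0 s) B)
substF k s (∀' B) = ∀' (substF (suc k) (shiftT 0 s) B)

-- [t/x]B  where B is the body of a quantifier ∃x B / ∀x B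
[_/x]_ : Term → Fm → Fm
[ t /x] B = substF 0 t B

data OccT (c : ℕ) : Term → Set where
  here  : OccT c (const c)
  inApp : ∀ {f ts} → Any (OccT c) ts → OccT c (app f ts)

data OccF (c : ℕ) : Fm → Set where
  inAtom : ∀ {p ts} → Any (OccT c) ts → OccF c (atom p ts)
  ∧ˡ : ∀ {A B} → OccF c A → OccF c (A ∧' B)
  ∧ʳ : ∀ {A B} → OccF c B → OccF c (A ∧' B)
  ∨ˡ : ∀ {A B} → OccF c A → OccF c (A ∨' B)
  ∨ʳ : ∀ {A B} → OccF c B → OccF c (A ∨' B)
  ⊃ˡ : ∀ {A B} → OccF c A → OccF c (A ⊃ B)
  ⊃ʳ : ∀ {A B} → OccF c B → OccF c (A ⊃ B)
  ∃o : ∀ {B} → OccF c B → OccF c (∃' B)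
  ∀o : ∀ {B} → OccF c B → OccF c (∀' B)

Fresh : ℕ → Fm → List Fm → Fm → Set
Fresh c G Δ F = ¬ Any (OccF c) Δ × ¬ OccF c F × ¬ OccF c G

-- The I_G calculus.  Antecedents are multisets, represented as lists
-- taken up to permutation: each left rule applies to any antecedent Δ'
-- that is a permutation of (principal formula(s) ∷ Δ).

data IG (G : Fm) : List Fm → Fm → Set where
  ax-⊤    : ∀ {Δ} → IG G Δ ⊤'
  ax-atom : ∀ {Δ p ts} → atom p ts ∈ Δ → IG G Δ (atom p ts)
  ax-⊥    : ∀ {Δ} → ⊥' ∈ Δ → IG G Δ ⊥'
  contr-L : ∀ {Δ Δ' B F} → Δ' ↭ (B ∷ Δ) →
            IG G (B ∷ B ∷ Δ) F → IG G Δ' F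
  ⊥-R     : ∀ {Δ F} → IG G Δ ⊥' → IG G Δ F
  ∧-L     : ∀ {Δ Δ' B D F} → Δ' ↭ ((B ∧' D) ∷ Δ) →
            IG G (B ∷ D ∷ (B ∧' D) ∷ Δ) F → IG G Δ' F
  ∧-R     : ∀ {Δ B D} → IG G Δ B → IG G Δ D → IG G Δ (B ∧' D)
  ∨-R₁    : ∀ {Δ B D} → IG G Δ B → IG G Δ (B ∨' D)
  ∨-R₂    : ∀ {Δ B D} → IG G Δ D → IG G Δ (B ∨' D)
  ⊃-L     : ∀ {Δ Δ' B D F} → Δ' ↭ ((B ⊃ D) ∷ Δ) →
            IG G ((B ⊃ D) ∷ Δ) B → IG G (D ∷ Δ) F → IG G Δ' F
  ⊃-R     : ∀ {Δ B D} → IG G (B ∷ Δ) D → IG G Δ (B ⊃ D)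
  ∀-L     : ∀ {Δ Δ' B F} (t : Term) → Δ' ↭ (∀' B ∷ Δ) →
            IG G (([ t /x] B) ∷ ∀' B ∷ Δ) F → IG G Δ' F
  ∃-R     : ∀ {Δ B} (t : Term) → IG G Δ ([ t /x] B) → IG G Δ (∃' B)
  ∃-L     : ∀ {Δ Δ' B F} (c : ℕ) → Δ' ↭ (∃' B ∷ Δ) → Fresh c G Δ' F →
            IG G (([ const c /x] B) ∷ Δ) F → IG G Δ' F
  ∀-R     : ∀ {Δ B} (c : ℕ) → Fresh c G Δ (∀' B) →
            IG G Δ ([ const c /x] B) → IG G Δ (∀' B)
  ∨-L     : ∀ {Δ Δ' B D F} → Δ' ↭ ((B ∨' D) ∷ Δ) →
            IG G (B ∷ Δ) F → IG G (D ∷ Δ) G → IG G Δ' F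
  res     : ∀ {Δ F} → IG G Δ G → IG G Δ F

-- O_G-proofs: every sequent whose succedent has top-level symbol among
-- ∧, ∨, ⊃, ∃, ∀ is the conclusion of the right rule for that symbol.

Compound : Fm → Set
Compound (_ ∧' _) = ⊤
Compound (_ ∨' _) = ⊤
Compound (_ ⊃ _)  = ⊤
Compound (∃' _)   = ⊤
Compound (∀' _)   = ⊤
Compound _        = Data.Empty.⊥
  where import Data.Empty

IsO : ∀ {G Δ F} → IG G Δ F → Set
IsO ax-⊤ = ⊤
IsO {F = F} (ax-atom _) = ⊤
IsO (ax-⊥ _) = ⊤
IsO {F = F} (contr-L _ d) = ¬ Compound F × IsO d
IsO {F = F} (⊥-R d) = ¬ Compound F × IsO d
IsO {F = F} (∧-L _ d) = ¬ Compound F × IsO d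
IsO (∧-R d e) = IsO d × IsO e
IsO (∨-R₁ d) = IsO d
IsO (∨-R₂ d) = IsO d
IsO {F = F} (⊃-L _ d e) = ¬ Compound F × IsO d × IsO e
IsO (⊃-R d) = IsO d
IsO {F = F} (∀-L _ _ d) = ¬ Compound F × IsO d
IsO (∃-R _ d) = IsO d
IsO {F = F} (∃-L _ _ _ d) = ¬ Compound F × IsO d
IsO (∀-R _ _ d) = IsO d
IsO {F = F} (∨-L _ d e) = ¬ Compound F × IsO d × IsO e
IsO {F = F} (res d) = ¬ Compound F × IsO d

mutual
  data IsGF : Fm → Set where
    g⊤ : IsGF ⊤'
    g⊥ : IsGF ⊥'
    gA : ∀ {p ts} → IsGF (atom p ts)
    g∧ : ∀ {A B} → IsGF A → IsGF B → IsGF (A ∧' B)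
    g∨ : ∀ {A B} → IsGF A → IsGF B → IsGF (A ∨' B)
    g⊃ : ∀ {A B} → IsDF A → IsGF B → IsGF (A ⊃ B)
    g∃ : ∀ {B} → IsGF B → IsGF (∃' B)

  data IsDF : Fm → Set where
    d⊤ : IsDF ⊤'
    d⊥ : IsDF ⊥'
    dA : ∀ {p ts} → IsDF (atom p ts)
    d⊃ : ∀ {A B} → IsGF A → IsDF B → IsDF (A ⊃ B)
    d∧ : ∀ {A B} → IsDF A → IsDF B → IsDF (A ∧' B)
    d∨ : ∀ {A B} → IsDF A → IsDF B → IsDF (A ∨' B)
    d∃ : ∀ {B} → IsDF B → IsDF (∃' B)
    d∀ : ∀ {B} → IsDF B → IsDF (∀' B)

{-# OPTIONS --safe #-}
-- The proof is semantic. Worlds are antecedents ordered by inclusion, and a world is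
-- explosive when every sequent over it with a non-compound succedent has an O_G-proof.
-- Forcing of atoms and ⊥ means O_G-provability in all larger worlds, and the compound
-- G-formula clauses follow the right rules, so a forced formula has an O_G-proof that
-- ends with its right rule.  Conversely a hereditarily explosive world forces every
-- G-formula, and a world forcing G (or ⊥) is explosive by res_G (or ⊥-R).
-- Every I_G-derivation with D-formula antecedent and G-formula succedent is sound for
-- the double negation of forcing, explosion playing the role of falsity.  For Γ ⟶ G
-- this makes Γ hereditarily explosive, so Γ forces G and Γ ⟶ G has an O_G-proof.
module Submission where

open import Defs
open import Data.Nat using (ℕ; zero; suc; _+_; _⊔_; _<_; _<ᵇ_; _≡ᵇ_; _≟_; s≤s)
open import Data.Nat.Properties using (m≤m+n; m≤n+m; m<n⇒m<n⊔o; m<n⇒m<o⊔n; <-irrefl; ≤-refl; ≤-reflexive)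
open import Data.Nat.Induction using (<-wellFounded)
open import Induction.WellFounded using (Acc; acc)
open import Data.Bool using (true; false)
open import Data.List using (List; []; _∷_; _++_; [_]; map)
open import Data.List.Properties using (map-id; map-cong)
open import Data.List.Relation.Unary.Any using (Any; here; there)
open import Data.List.Relation.Unary.All using (All; []; _∷_)
open import Data.List.Membership.Propositional using (_∈_)
open import Data.List.Membership.Propositional.Properties using (∈-map⁺; ∈-∃++)
open import Data.List.Relation.Binary.Subset.Propositional using (_⊆_)
open import Data.List.Relation.Binary.Subset.Propositional.Properties
  using (⊆-refl; ⊆-trans; ⊆-reflexive-↭; xs⊆x∷xs; xs⊆ys++xs; ∷⁺ʳ; ∈-∷⁺ʳ; ++⁺ʳ; map⁺; Any-resp-⊆)
open import Data.List.Relation.Binary.Permutation.Propositional using (_↭_; ↭-refl; ↭-sym)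
open import Data.List.Relation.Binary.Permutation.Propositional.Properties using (All-resp-↭; shift)
open import Data.Product using (Σ; ∃; _,_)
open import Data.Unit using (tt)
open import Data.Empty using (⊥-elim)
open import Function using (_∘_)
open import Relation.Nullary using (¬_; yes; no)
open import Relation.Binary.PropositionalEquality
  using (_≡_; _≢_; refl; trans; cong; cong₂; subst; subst₂)

∈⇒↭∷ : ∀ {a} {A : Set a} {x : A} {xs} → x ∈ xs → ∃ λ ys → xs ↭ x ∷ ys
∈⇒↭∷ {x = x} x∈xs with ys , zs , refl ← ∈-∃++ x∈xs = ys ++ zs , shift x ys zs

mutual
  renT : (ℕ → ℕ) → Term → Term
  renT ρ (var n)    = var n
  renT ρ (const c)  = const (ρ c)
  renT ρ (app f ts) = app f (renTs ρ ts)

  renTs : (ℕ → ℕ) → List Term → List Term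
  renTs ρ []       = []
  renTs ρ (t ∷ ts) = renT ρ t ∷ renTs ρ ts

renF : (ℕ → ℕ) → Fm → Fm
renF ρ ⊤'          = ⊤'
renF ρ ⊥'          = ⊥'
renF ρ (atom p ts) = atom p (renTs ρ ts)
renF ρ (A ∧' B)    = renF ρ A ∧' renF ρ B
renF ρ (A ∨' B)    = renF ρ A ∨' renF ρ B
renF ρ (A ⊃ B)     = renF ρ A ⊃ renF ρ B
renF ρ (∃' B)      = ∃' (renF ρ B)
renF ρ (∀' B)      = ∀' (renF ρ B)

renL : (ℕ → ℕ) → List Fm → List Fm
renL ρ = map (renF ρ)

mutual
  renT-shiftT : ∀ ρ k t → renT ρ (shiftT k t) ≡ shiftT k (renT ρ t)
  renT-shiftT ρ k (var n) with n <ᵇ k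
  ... | true  = refl
  ... | false = refl
  renT-shiftT ρ k (const c)  = refl
  renT-shiftT ρ k (app f ts) = cong (app f) (renTs-shiftTs ρ k ts)

  renTs-shiftTs : ∀ ρ k ts → renTs ρ (shiftTs k ts) ≡ shiftTs k (renTs ρ ts)
  renTs-shiftTs ρ k []       = refl
  renTs-shiftTs ρ k (t ∷ ts) = cong₂ _∷_ (renT-shiftT ρ k t) (renTs-shiftTs ρ k ts)

mutual
  renT-substT : ∀ ρ k s t → renT ρ (substT k s t) ≡ substT k (renT ρ s) (renT ρ t)
  renT-substT ρ k s (var zero) with k ≡ᵇ zero
  ... | true  = refl
  ... | false = refl
  renT-substT ρ k s (var (suc n)) with n <ᵇ k | suc n ≡ᵇ k
  ... | true  | true  = refl
  ... | true  | false = refl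
  ... | false | _     = refl
  renT-substT ρ k s (const c)  = refl
  renT-substT ρ k s (app f ts) = cong (app f) (renTs-substTs ρ k s ts)

  renTs-substTs : ∀ ρ k s ts → renTs ρ (substTs k s ts) ≡ substTs k (renT ρ s) (renTs ρ ts)
  renTs-substTs ρ k s []       = refl
  renTs-substTs ρ k s (t ∷ ts) = cong₂ _∷_ (renT-substT ρ k s t) (renTs-substTs ρ k s ts)

renF-substF : ∀ ρ k s B → renF ρ (substF k s B) ≡ substF k (renT ρ s) (renF ρ B)
renF-substF ρ k s ⊤'          = refl
renF-substF ρ k s ⊥'          = refl
renF-substF ρ k s (atom p ts) = cong (atom p) (renTs-substTs ρ k s ts)
renF-substF ρ k s (A ∧' B)    = cong₂ _∧'_ (renF-substF ρ k s A) (renF-substF ρ k s B)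
renF-substF ρ k s (A ∨' B)    = cong₂ _∨'_ (renF-substF ρ k s A) (renF-substF ρ k s B)
renF-substF ρ k s (A ⊃ B)     = cong₂ _⊃_ (renF-substF ρ k s A) (renF-substF ρ k s B)
renF-substF ρ k s (∃' B)      = cong ∃' (trans (renF-substF ρ (suc k) (shiftT 0 s) B)
  (cong (λ u → substF (suc k) u (renF ρ B)) (renT-shiftT ρ 0 s)))
renF-substF ρ k s (∀' B)      = cong ∀' (trans (renF-substF ρ (suc k) (shiftT 0 s) B)
  (cong (λ u → substF (suc k) u (renF ρ B)) (renT-shiftT ρ 0 s)))

mutual
  renT-id : ∀ t → renT (λ c → c) t ≡ t
  renT-id (var n)    = refl
  renT-id (const c)  = refl
  renT-id (app f ts) = cong (app f) (renTs-id ts)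

  renTs-id : ∀ ts → renTs (λ c → c) ts ≡ ts
  renTs-id []       = refl
  renTs-id (t ∷ ts) = cong₂ _∷_ (renT-id t) (renTs-id ts)

renF-id : ∀ B → renF (λ c → c) B ≡ B
renF-id ⊤'          = refl
renF-id ⊥'          = refl
renF-id (atom p ts) = cong (atom p) (renTs-id ts)
renF-id (A ∧' B)    = cong₂ _∧'_ (renF-id A) (renF-id B)
renF-id (A ∨' B)    = cong₂ _∨'_ (renF-id A) (renF-id B)
renF-id (A ⊃ B)     = cong₂ _⊃_ (renF-id A) (renF-id B)
renF-id (∃' B)      = cong ∃' (renF-id B)
renF-id (∀' B)      = cong ∀' (renF-id B)

renL-id : ∀ Δ → renL (λ c → c) Δ ≡ Δ
renL-id Δ = trans (map-cong renF-id Δ) (map-id Δ)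

mutual
  renT-cong : ∀ {ρ σ} t → (∀ {c} → OccT c t → ρ c ≡ σ c) → renT ρ t ≡ renT σ t
  renT-cong (var n)    eq = refl
  renT-cong (const c)  eq = cong const (eq here)
  renT-cong (app f ts) eq = cong (app f) (renTs-cong ts (eq ∘ inApp))

  renTs-cong : ∀ {ρ σ} ts → (∀ {c} → Any (OccT c) ts → ρ c ≡ σ c) → renTs ρ ts ≡ renTs σ ts
  renTs-cong []       eq = refl
  renTs-cong (t ∷ ts) eq = cong₂ _∷_ (renT-cong t (eq ∘ here)) (renTs-cong ts (eq ∘ there))

renF-cong : ∀ {ρ σ} B → (∀ {c} → OccF c B → ρ c ≡ σ c) → renF ρ B ≡ renF σ B
renF-cong ⊤'          eq = refl
renF-cong ⊥'          eq = refl
renF-cong (atom p ts) eq = cong (atom p) (renTs-cong ts (eq ∘ inAtom))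
renF-cong (A ∧' B)    eq = cong₂ _∧'_ (renF-cong A (eq ∘ ∧ˡ)) (renF-cong B (eq ∘ ∧ʳ))
renF-cong (A ∨' B)    eq = cong₂ _∨'_ (renF-cong A (eq ∘ ∨ˡ)) (renF-cong B (eq ∘ ∨ʳ))
renF-cong (A ⊃ B)     eq = cong₂ _⊃_ (renF-cong A (eq ∘ ⊃ˡ)) (renF-cong B (eq ∘ ⊃ʳ))
renF-cong (∃' B)      eq = cong ∃' (renF-cong B (eq ∘ ∃o))
renF-cong (∀' B)      eq = cong ∀' (renF-cong B (eq ∘ ∀o))

upd : (ℕ → ℕ) → ℕ → ℕ → ℕ → ℕ
upd ρ c c′ d with d ≟ c
... | yes _ = c′
... | no  _ = ρ d

upd-≡ : ∀ ρ c c′ → upd ρ c c′ c ≡ c′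
upd-≡ ρ c c′ with c ≟ c
... | yes _   = refl
... | no c≢c = ⊥-elim (c≢c refl)

upd-≢ : ∀ ρ {c} c′ {d} → d ≢ c → upd ρ c c′ d ≡ ρ d
upd-≢ ρ {c} c′ {d} d≢c with d ≟ c
... | yes d≡c = ⊥-elim (d≢c d≡c)
... | no  _   = refl

renF-upd-fresh : ∀ {ρ c c′} B → ¬ OccF c B → renF (upd ρ c c′) B ≡ renF ρ B
renF-upd-fresh {ρ} {c′ = c′} B c∉B = renF-cong B (λ d∈B → upd-≢ ρ c′ λ { refl → c∉B d∈B })

renL-upd-fresh : ∀ {ρ c c′} Δ → ¬ Any (OccF c) Δ → renL (upd ρ c c′) Δ ≡ renL ρ Δ
renL-upd-fresh []      c∉ = refl
renL-upd-fresh {ρ} {c} {c′} (B ∷ Δ) c∉ = cong₂ _∷_ (renF-upd-fresh {ρ} {c} {c′} B (c∉ ∘ here)) (renL-upd-fresh Δ (c∉ ∘ there))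

renL-upd-eigen : ∀ {ρ c c′} B Δ → ¬ Any (OccF c) (∃' B ∷ Δ) →
  renL (upd ρ c c′) ([ const c /x] B ∷ Δ) ≡ [ const c′ /x] renF ρ B ∷ renL ρ Δ
renL-upd-eigen {ρ} {c} {c′} B Δ c∉ = cong₂ _∷_
  (trans (renF-substF (upd ρ c c′) 0 (const c) B)
         (cong₂ (λ d B′ → [ const d /x] B′) (upd-≡ ρ c c′) (renF-upd-fresh {ρ} {c} {c′} B (λ o → c∉ (here (∃o o))))))
  (renL-upd-fresh {ρ} {c} {c′} Δ (c∉ ∘ there))

renL-↭⊆ : ∀ ρ {X Δ Δ′} → Δ′ ↭ X ∷ Δ → renL ρ (X ∷ Δ) ⊆ renL ρ Δ′
renL-↭⊆ ρ p = map⁺ (renF ρ) (⊆-reflexive-↭ (↭-sym p))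

mutual
  constBoundT : Term → ℕ
  constBoundT (var n)    = 0
  constBoundT (const c)  = suc c
  constBoundT (app f ts) = constBoundTs ts

  constBoundTs : List Term → ℕ
  constBoundTs []       = 0
  constBoundTs (t ∷ ts) = constBoundT t ⊔ constBoundTs ts

constBoundF : Fm → ℕ
constBoundF ⊤'          = 0
constBoundF ⊥'          = 0
constBoundF (atom p ts) = constBoundTs ts
constBoundF (A ∧' B)    = constBoundF A ⊔ constBoundF B
constBoundF (A ∨' B)    = constBoundF A ⊔ constBoundF B
constBoundF (A ⊃ B)     = constBoundF A ⊔ constBoundF B
constBoundF (∃' B)      = constBoundF B
constBoundF (∀' B)      = constBoundF B

constBoundL : List Fm → ℕ
constBoundL []      = 0
constBoundL (A ∷ Δ) = constBoundF A ⊔ constBoundL Δ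

mutual
  OccT⇒< : ∀ {c t} → OccT c t → c < constBoundT t
  OccT⇒< here      = ≤-refl
  OccT⇒< (inApp o) = OccTs⇒< o

  OccTs⇒< : ∀ {c ts} → Any (OccT c) ts → c < constBoundTs ts
  OccTs⇒< {ts = t ∷ ts} (here o)  = m<n⇒m<n⊔o (constBoundTs ts) (OccT⇒< o)
  OccTs⇒< {ts = t ∷ ts} (there o) = m<n⇒m<o⊔n (constBoundT t) (OccTs⇒< o)

OccF⇒< : ∀ {c B} → OccF c B → c < constBoundF B
OccF⇒< (inAtom o)            = OccTs⇒< o
OccF⇒< {B = A ∧' B} (∧ˡ o) = m<n⇒m<n⊔o (constBoundF B) (OccF⇒< o)
OccF⇒< {B = A ∧' B} (∧ʳ o) = m<n⇒m<o⊔n (constBoundF A) (OccF⇒< o)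
OccF⇒< {B = A ∨' B} (∨ˡ o) = m<n⇒m<n⊔o (constBoundF B) (OccF⇒< o)
OccF⇒< {B = A ∨' B} (∨ʳ o) = m<n⇒m<o⊔n (constBoundF A) (OccF⇒< o)
OccF⇒< {B = A ⊃ B} (⊃ˡ o)  = m<n⇒m<n⊔o (constBoundF B) (OccF⇒< o)
OccF⇒< {B = A ⊃ B} (⊃ʳ o)  = m<n⇒m<o⊔n (constBoundF A) (OccF⇒< o)
OccF⇒< (∃o o)                = OccF⇒< o
OccF⇒< (∀o o)                = OccF⇒< o

OccL⇒< : ∀ {c Δ} → Any (OccF c) Δ → c < constBoundL Δ
OccL⇒< {Δ = A ∷ Δ} (here o)  = m<n⇒m<n⊔o (constBoundL Δ) (OccF⇒< o)
OccL⇒< {Δ = A ∷ Δ} (there o) = m<n⇒m<o⊔n (constBoundF A) (OccL⇒< o)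

fresh : ∀ G Δ F → ∃ λ c → Fresh c G Δ F
fresh G Δ F = c , c∉ ∘ there ∘ there , c∉ ∘ there ∘ here , c∉ ∘ here
  where
  c = constBoundL (G ∷ F ∷ Δ)
  c∉ : ¬ Any (OccF c) (G ∷ F ∷ Δ)
  c∉ o = <-irrefl refl (OccL⇒< o)

mutual
  IsGF-substF : ∀ {B} k s → IsGF B → IsGF (substF k s B)
  IsGF-substF k s g⊤       = g⊤
  IsGF-substF k s g⊥       = g⊥
  IsGF-substF k s gA       = gA
  IsGF-substF k s (g∧ a b) = g∧ (IsGF-substF k s a) (IsGF-substF k s b)
  IsGF-substF k s (g∨ a b) = g∨ (IsGF-substF k s a) (IsGF-substF k s b)
  IsGF-substF k s (g⊃ a b) = g⊃ (IsDF-substF k s a) (IsGF-substF k s b)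
  IsGF-substF k s (g∃ b)   = g∃ (IsGF-substF (suc k) (shiftT 0 s) b)

  IsDF-substF : ∀ {B} k s → IsDF B → IsDF (substF k s B)
  IsDF-substF k s d⊤       = d⊤
  IsDF-substF k s d⊥       = d⊥
  IsDF-substF k s dA       = dA
  IsDF-substF k s (d⊃ a b) = d⊃ (IsGF-substF k s a) (IsDF-substF k s b)
  IsDF-substF k s (d∧ a b) = d∧ (IsDF-substF k s a) (IsDF-substF k s b)
  IsDF-substF k s (d∨ a b) = d∨ (IsDF-substF k s a) (IsDF-substF k s b)
  IsDF-substF k s (d∃ b)   = d∃ (IsDF-substF (suc k) (shiftT 0 s) b)
  IsDF-substF k s (d∀ b)   = d∀ (IsDF-substF (suc k) (shiftT 0 s) b)

mutual
  IsGF-renF : ∀ {B} ρ → IsGF B → IsGF (renF ρ B)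
  IsGF-renF ρ g⊤       = g⊤
  IsGF-renF ρ g⊥       = g⊥
  IsGF-renF ρ gA       = gA
  IsGF-renF ρ (g∧ a b) = g∧ (IsGF-renF ρ a) (IsGF-renF ρ b)
  IsGF-renF ρ (g∨ a b) = g∨ (IsGF-renF ρ a) (IsGF-renF ρ b)
  IsGF-renF ρ (g⊃ a b) = g⊃ (IsDF-renF ρ a) (IsGF-renF ρ b)
  IsGF-renF ρ (g∃ b)   = g∃ (IsGF-renF ρ b)

  IsDF-renF : ∀ {B} ρ → IsDF B → IsDF (renF ρ B)
  IsDF-renF ρ d⊤       = d⊤
  IsDF-renF ρ d⊥       = d⊥
  IsDF-renF ρ dA       = dA
  IsDF-renF ρ (d⊃ a b) = d⊃ (IsGF-renF ρ a) (IsDF-renF ρ b)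
  IsDF-renF ρ (d∧ a b) = d∧ (IsDF-renF ρ a) (IsDF-renF ρ b)
  IsDF-renF ρ (d∨ a b) = d∨ (IsDF-renF ρ a) (IsDF-renF ρ b)
  IsDF-renF ρ (d∃ b)   = d∃ (IsDF-renF ρ b)
  IsDF-renF ρ (d∀ b)   = d∀ (IsDF-renF ρ b)

size : Fm → ℕ
size (A ∧' B) = suc (size A + size B)
size (A ∨' B) = suc (size A + size B)
size (A ⊃ B)  = suc (size A + size B)
size (∃' B)   = suc (size B)
size (∀' B)   = suc (size B)
size _        = 1

size-substF : ∀ k s B → size (substF k s B) ≡ size B
size-substF k s ⊤'          = refl
size-substF k s ⊥'          = refl
size-substF k s (atom p ts) = refl
size-substF k s (A ∧' B)    = cong₂ (λ m n → suc (m + n)) (size-substF k s A) (size-substF k s B)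
size-substF k s (A ∨' B)    = cong₂ (λ m n → suc (m + n)) (size-substF k s A) (size-substF k s B)
size-substF k s (A ⊃ B)     = cong₂ (λ m n → suc (m + n)) (size-substF k s A) (size-substF k s B)
size-substF k s (∃' B)      = cong suc (size-substF (suc k) (shiftT 0 s) B)
size-substF k s (∀' B)      = cong suc (size-substF (suc k) (shiftT 0 s) B)

module Model (G : Fm) (G-isGF : IsGF G) where

  infix 3 _⊢ₒ_ _⊩_ _⊩¬_ _⊨_

  _⊢ₒ_ : List Fm → Fm → Set
  Δ ⊢ₒ F = Σ (IG G Δ F) IsO

  □ : (List Fm → Set) → List Fm → Set
  □ P Θ = ∀ {Ψ} → Θ ⊆ Ψ → P Ψ

  □-mono : ∀ {P Θ Ψ} → □ P Θ → Θ ⊆ Ψ → □ P Ψ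
  □-mono p Θ⊆Ψ Ψ⊆Ψ′ = p (⊆-trans Θ⊆Ψ Ψ⊆Ψ′)

  Explosive : List Fm → Set
  Explosive Ψ = ∀ A → ¬ Compound A → Ψ ⊢ₒ A

  ⊥-Rₒ : ∀ {Ψ A} → ¬ Compound A → Ψ ⊢ₒ ⊥' → Ψ ⊢ₒ A
  ⊥-Rₒ nc (d , o) = ⊥-R d , nc , o

  resₒ : ∀ {Ψ A} → ¬ Compound A → Ψ ⊢ₒ G → Ψ ⊢ₒ A
  resₒ nc (d , o) = res d , nc , o

  ∧-Lₒ : ∀ {Ψ Ψ₀ B D A} → ¬ Compound A → Ψ ↭ (B ∧' D) ∷ Ψ₀ →
         B ∷ D ∷ (B ∧' D) ∷ Ψ₀ ⊢ₒ A → Ψ ⊢ₒ A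
  ∧-Lₒ nc Ψ↭ (d , o) = ∧-L Ψ↭ d , nc , o

  ∀-Lₒ : ∀ {Ψ Ψ₀ B A} t → ¬ Compound A → Ψ ↭ ∀' B ∷ Ψ₀ →
         [ t /x] B ∷ ∀' B ∷ Ψ₀ ⊢ₒ A → Ψ ⊢ₒ A
  ∀-Lₒ t nc Ψ↭ (d , o) = ∀-L t Ψ↭ d , nc , o

  -- ⊃-L, ∨-L and ∃-L drop their principal formula; contracting it first keeps the
  -- antecedent of every premise a superset of Ψ, as the monotone model requires.
  ⊃-Lₒ : ∀ {Ψ Ψ₀ B D A} → ¬ Compound A → Ψ ↭ (B ⊃ D) ∷ Ψ₀ →
         (B ⊃ D) ∷ (B ⊃ D) ∷ Ψ₀ ⊢ₒ B → D ∷ (B ⊃ D) ∷ Ψ₀ ⊢ₒ A → Ψ ⊢ₒ A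
  ⊃-Lₒ nc Ψ↭ (l , oₗ) (r , oᵣ) = contr-L Ψ↭ (⊃-L ↭-refl l r) , nc , nc , oₗ , oᵣ

  ∨-Lₒ : ∀ {Ψ Ψ₀ B D A} → ¬ Compound A → Ψ ↭ (B ∨' D) ∷ Ψ₀ →
         B ∷ (B ∨' D) ∷ Ψ₀ ⊢ₒ A → D ∷ (B ∨' D) ∷ Ψ₀ ⊢ₒ G → Ψ ⊢ₒ A
  ∨-Lₒ nc Ψ↭ (l , oₗ) (r , oᵣ) = contr-L Ψ↭ (∨-L ↭-refl l r) , nc , nc , oₗ , oᵣ

  ∃-Lₒ : ∀ {Ψ Ψ₀ B A} c → ¬ Compound A → Ψ ↭ ∃' B ∷ Ψ₀ → Fresh c G (∃' B ∷ ∃' B ∷ Ψ₀) A →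
         [ const c /x] B ∷ ∃' B ∷ Ψ₀ ⊢ₒ A → Ψ ⊢ₒ A
  ∃-Lₒ c nc Ψ↭ c-fresh (d , o) = contr-L Ψ↭ (∃-L c ↭-refl c-fresh d) , nc , nc , o

  data _⊩_ : List Fm → Fm → Set where
    ⊩-⊤    : ∀ {Θ} → Θ ⊩ ⊤'
    ⊩-⊥    : ∀ {Θ} → □ (_⊢ₒ ⊥') Θ → Θ ⊩ ⊥'
    ⊩-atom : ∀ {Θ p ts} → □ (_⊢ₒ atom p ts) Θ → Θ ⊩ atom p ts
    ⊩-∧    : ∀ {Θ A B} → Θ ⊩ A → Θ ⊩ B → Θ ⊩ A ∧' B
    ⊩-∨₁   : ∀ {Θ A B} → Θ ⊩ A → Θ ⊩ A ∨' B
    ⊩-∨₂   : ∀ {Θ A B} → Θ ⊩ B → Θ ⊩ A ∨' B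
    ⊩-⊃    : ∀ {Θ A B} → A ∷ Θ ⊩ B → Θ ⊩ A ⊃ B
    ⊩-∃    : ∀ {Θ B} t → Θ ⊩ [ t /x] B → Θ ⊩ ∃' B

  ⊩-mono : ∀ {Θ Ψ F} → Θ ⊆ Ψ → Θ ⊩ F → Ψ ⊩ F
  ⊩-mono Θ⊆Ψ ⊩-⊤        = ⊩-⊤
  ⊩-mono Θ⊆Ψ (⊩-⊥ p)    = ⊩-⊥ (□-mono p Θ⊆Ψ)
  ⊩-mono Θ⊆Ψ (⊩-atom p) = ⊩-atom (□-mono p Θ⊆Ψ)
  ⊩-mono Θ⊆Ψ (⊩-∧ a b)  = ⊩-∧ (⊩-mono Θ⊆Ψ a) (⊩-mono Θ⊆Ψ b)
  ⊩-mono Θ⊆Ψ (⊩-∨₁ a)   = ⊩-∨₁ (⊩-mono Θ⊆Ψ a)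
  ⊩-mono Θ⊆Ψ (⊩-∨₂ b)   = ⊩-∨₂ (⊩-mono Θ⊆Ψ b)
  ⊩-mono Θ⊆Ψ (⊩-⊃ b)    = ⊩-⊃ (⊩-mono (∷⁺ʳ _ Θ⊆Ψ) b)
  ⊩-mono Θ⊆Ψ (⊩-∃ t b)  = ⊩-∃ t (⊩-mono Θ⊆Ψ b)

  ⊩⇒⊢ₒ : ∀ {Θ F} → Θ ⊩ F → Θ ⊢ₒ F
  ⊩⇒⊢ₒ ⊩-⊤        = ax-⊤ , tt
  ⊩⇒⊢ₒ (⊩-⊥ p)    = p ⊆-refl
  ⊩⇒⊢ₒ (⊩-atom p) = p ⊆-refl
  ⊩⇒⊢ₒ (⊩-∧ a b) with ⊩⇒⊢ₒ a | ⊩⇒⊢ₒ b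
  ... | d , o | e , o′ = ∧-R d e , o , o′
  ⊩⇒⊢ₒ (⊩-∨₁ a) with ⊩⇒⊢ₒ a
  ... | d , o = ∨-R₁ d , o
  ⊩⇒⊢ₒ (⊩-∨₂ b) with ⊩⇒⊢ₒ b
  ... | d , o = ∨-R₂ d , o
  ⊩⇒⊢ₒ (⊩-⊃ b) with ⊩⇒⊢ₒ b
  ... | d , o = ⊃-R d , o
  ⊩⇒⊢ₒ (⊩-∃ t b) with ⊩⇒⊢ₒ b
  ... | d , o = ∃-R t d , o

  □Explosive⇒⊩ : ∀ {Θ F} → IsGF F → □ Explosive Θ → Θ ⊩ F
  □Explosive⇒⊩ g = go g (<-wellFounded _)
    where
    go : ∀ {Θ F} → IsGF F → Acc _<_ (size F) → □ Explosive Θ → Θ ⊩ F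
    go g⊤ _ e = ⊩-⊤
    go g⊥ _ e = ⊩-⊥ (λ Θ⊆Ψ → e Θ⊆Ψ ⊥' λ ())
    go gA _ e = ⊩-atom (λ Θ⊆Ψ → e Θ⊆Ψ _ λ ())
    go (g∧ a b) (acc rs) e = ⊩-∧ (go a (rs (s≤s (m≤m+n _ _))) e) (go b (rs (s≤s (m≤n+m _ _))) e)
    go (g∨ a _) (acc rs) e = ⊩-∨₁ (go a (rs (s≤s (m≤m+n _ _))) e)
    go (g⊃ _ b) (acc rs) e = ⊩-⊃ (go b (rs (s≤s (m≤n+m _ _))) (□-mono e (xs⊆x∷xs _ _)))
    go (g∃ {B} b) (acc rs) e =
      ⊩-∃ (const 0) (go (IsGF-substF 0 (const 0) b)
                        (rs (s≤s (≤-reflexive (size-substF 0 (const 0) B)))) e)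

  □Explosive⇒⊢ₒG : ∀ {Θ} → □ Explosive Θ → Θ ⊢ₒ G
  □Explosive⇒⊢ₒG e = ⊩⇒⊢ₒ (□Explosive⇒⊩ G-isGF e)

  ⊩G⇒Explosive : ∀ {Θ} → Θ ⊩ G → Explosive Θ
  ⊩G⇒Explosive f A nc = resₒ nc (⊩⇒⊢ₒ f)

  ⊩⊥⇒Explosive : ∀ {Θ} → Θ ⊩ ⊥' → Explosive Θ
  ⊩⊥⇒Explosive f A nc = ⊥-Rₒ nc (⊩⇒⊢ₒ f)

  _⊩¬_ : List Fm → Fm → Set
  Ψ ⊩¬ F = □ (λ Ψ′ → Ψ′ ⊩ F → Explosive Ψ′) Ψ

  _⊨_ : List Fm → Fm → Set
  Δ ⊨ F = □ (λ Ψ → Ψ ⊩¬ F → Explosive Ψ) Δ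

  ⊨-weaken : ∀ {Δ Δ′ F} → Δ ⊆ Δ′ → Δ ⊨ F → Δ′ ⊨ F
  ⊨-weaken Δ⊆Δ′ h = □-mono h Δ⊆Δ′

  ⊨G⇒□Explosive : ∀ {Δ} → Δ ⊨ G → □ Explosive Δ
  ⊨G⇒□Explosive h Δ⊆Ψ = h Δ⊆Ψ (λ _ → ⊩G⇒Explosive)

  ⊨-pure : ∀ {Δ F} → □ (_⊩ F) Δ → Δ ⊨ F
  ⊨-pure f Δ⊆Ψ k = k ⊆-refl (f Δ⊆Ψ)

  ⊨-map : ∀ {Δ B D} → (∀ {Ψ} → Ψ ⊩ B → Ψ ⊩ D) → Δ ⊨ B → Δ ⊨ D
  ⊨-map g h Δ⊆Ψ k = h Δ⊆Ψ (λ Ψ⊆Ψ′ → k Ψ⊆Ψ′ ∘ g)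

  ⊨-⊤ : ∀ {Δ} → Δ ⊨ ⊤'
  ⊨-⊤ = ⊨-pure (λ _ → ⊩-⊤)

  ⊨-premiseom : ∀ {Δ p ts} → atom p ts ∈ Δ → Δ ⊨ atom p ts
  ⊨-premiseom A∈Δ = ⊨-pure (λ Δ⊆Ψ → ⊩-atom (λ Ψ⊆Ψ′ → ax-atom (Ψ⊆Ψ′ (Δ⊆Ψ A∈Δ)) , tt))

  ⊨-⊥ : ∀ {Δ} → ⊥' ∈ Δ → Δ ⊨ ⊥'
  ⊨-⊥ ⊥∈Δ = ⊨-pure (λ Δ⊆Ψ → ⊩-⊥ (λ Ψ⊆Ψ′ → ax-⊥ (Ψ⊆Ψ′ (Δ⊆Ψ ⊥∈Δ)) , tt))

  ⊨-⊥-R : ∀ {Δ F} → Δ ⊨ ⊥' → Δ ⊨ F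
  ⊨-⊥-R h Δ⊆Ψ _ = h Δ⊆Ψ (λ _ → ⊩⊥⇒Explosive)

  ⊨-res : ∀ {Δ F} → Δ ⊨ G → Δ ⊨ F
  ⊨-res h Δ⊆Ψ _ = ⊨G⇒□Explosive h Δ⊆Ψ

  ⊨-∧-R : ∀ {Δ B D} → Δ ⊨ B → Δ ⊨ D → Δ ⊨ B ∧' D
  ⊨-∧-R h₁ h₂ Δ⊆Ψ k =
    h₁ Δ⊆Ψ λ Ψ⊆Ψ₁ f₁ → h₂ (⊆-trans Δ⊆Ψ Ψ⊆Ψ₁) λ Ψ₁⊆Ψ₂ f₂ →
      k (⊆-trans Ψ⊆Ψ₁ Ψ₁⊆Ψ₂) (⊩-∧ (⊩-mono Ψ₁⊆Ψ₂ f₁) f₂)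

  ⊨-⊃-R : ∀ {Δ B D} → IsGF D → B ∷ Δ ⊨ D → Δ ⊨ B ⊃ D
  ⊨-⊃-R {B = B} gD h {Ψ} Δ⊆Ψ k = k ⊆-refl (⊩-⊃ (□Explosive⇒⊩ gD explosive))
    where
    explosive : □ Explosive (B ∷ Ψ)
    explosive B∷Ψ⊆Ψ′ = h (⊆-trans (∷⁺ʳ B Δ⊆Ψ) B∷Ψ⊆Ψ′) λ Ψ′⊆Ψ″ f →
      k (⊆-trans (xs⊆x∷xs Ψ B) (⊆-trans B∷Ψ⊆Ψ′ Ψ′⊆Ψ″)) (⊩-⊃ (⊩-mono (xs⊆x∷xs _ B) f))

  ⊨-premise : ∀ Π {Δ Ψ X Ψ₀ F} → Π ++ Δ ⊨ F → Δ ⊆ Ψ → Ψ ↭ X ∷ Ψ₀ → Ψ ⊩¬ F →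
         Explosive (Π ++ X ∷ Ψ₀)
  ⊨-premise Π h Δ⊆Ψ Ψ↭ k =
    h (++⁺ʳ Π (⊆-trans Δ⊆Ψ Ψ⊆)) (□-mono k (⊆-trans Ψ⊆ (xs⊆ys++xs _ Π)))
    where Ψ⊆ = ⊆-reflexive-↭ Ψ↭

  ⊨-∧-L : ∀ {Δ B D F} → (B ∧' D) ∈ Δ → B ∷ D ∷ Δ ⊨ F → Δ ⊨ F
  ⊨-∧-L {B = B} {D} X∈Δ h Δ⊆Ψ k A nc with Ψ₀ , Ψ↭ ← ∈⇒↭∷ (Δ⊆Ψ X∈Δ) =
    ∧-Lₒ nc Ψ↭ (⊨-premise (B ∷ D ∷ []) h Δ⊆Ψ Ψ↭ k A nc)

  ⊨-∀-L : ∀ {Δ B F} t → ∀' B ∈ Δ → [ t /x] B ∷ Δ ⊨ F → Δ ⊨ F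
  ⊨-∀-L {B = B} t X∈Δ h Δ⊆Ψ k A nc with Ψ₀ , Ψ↭ ← ∈⇒↭∷ (Δ⊆Ψ X∈Δ) =
    ∀-Lₒ t nc Ψ↭ (⊨-premise [ [ t /x] B ] h Δ⊆Ψ Ψ↭ k A nc)

  ⊨-∃-L : ∀ {Δ B F} → ∃' B ∈ Δ → (∀ c → [ const c /x] B ∷ Δ ⊨ F) → Δ ⊨ F
  ⊨-∃-L {B = B} X∈Δ h Δ⊆Ψ k A nc with ∈⇒↭∷ (Δ⊆Ψ X∈Δ)
  ... | Ψ₀ , Ψ↭ with fresh G (∃' B ∷ ∃' B ∷ Ψ₀) A
  ... | c , c-fresh =
    ∃-Lₒ c nc Ψ↭ c-fresh (⊨-premise [ [ const c /x] B ] (h c) Δ⊆Ψ Ψ↭ k A nc)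

  ⊨-⊃-L : ∀ {Δ B D F} → (B ⊃ D) ∈ Δ → Δ ⊨ B → D ∷ Δ ⊨ F → Δ ⊨ F
  ⊨-⊃-L {Δ} {B} {D} X∈Δ h₁ h₂ {Ψ} Δ⊆Ψ k = h₁ Δ⊆Ψ k₁
    where
    k₁ : Ψ ⊩¬ B
    k₁ Ψ⊆Ψ′ f A nc with Ψ₀ , Ψ′↭ ← ∈⇒↭∷ (Ψ⊆Ψ′ (Δ⊆Ψ X∈Δ)) =
      ⊃-Lₒ nc Ψ′↭ (⊩⇒⊢ₒ (⊩-mono (⊆-trans (⊆-reflexive-↭ Ψ′↭) (xs⊆x∷xs _ _)) f))
                  (⊨-premise [ D ] h₂ (⊆-trans Δ⊆Ψ Ψ⊆Ψ′) Ψ′↭ (□-mono k Ψ⊆Ψ′) A nc)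

  ⊨-∨-L : ∀ {Δ B D F} → (B ∨' D) ∈ Δ → B ∷ Δ ⊨ F → D ∷ Δ ⊨ G → Δ ⊨ F
  ⊨-∨-L {B = B} {D} X∈Δ h₁ h₂ Δ⊆Ψ k A nc with Ψ₀ , Ψ↭ ← ∈⇒↭∷ (Δ⊆Ψ X∈Δ) =
    ∨-Lₒ nc Ψ↭ (⊨-premise [ B ] h₁ Δ⊆Ψ Ψ↭ k A nc)
      (□Explosive⇒⊢ₒG (□-mono (⊨G⇒□Explosive h₂) (∷⁺ʳ D (⊆-trans Δ⊆Ψ (⊆-reflexive-↭ Ψ↭)))))

  -- Soundness is proved for every renaming of constants fixing G, so that ∃-L can
  -- replace its eigenconstant by one that is fresh for the current world.
  sound : ∀ ρ → renF ρ G ≡ G → ∀ {Δ F} → IG G Δ F → All IsDF Δ → IsGF F →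
          renL ρ Δ ⊨ renF ρ F
  sound ρ ρG ax-⊤         _ _ = ⊨-⊤
  sound ρ ρG (ax-atom A∈Δ) _ _ = ⊨-premiseom (∈-map⁺ (renF ρ) A∈Δ)
  sound ρ ρG (ax-⊥ ⊥∈Δ)   _ _ = ⊨-⊥ (∈-map⁺ (renF ρ) ⊥∈Δ)
  sound ρ ρG (contr-L p d) dΔ′ gF with All-resp-↭ p dΔ′
  ... | dB ∷ dΔ =
    ⊨-weaken (∈-∷⁺ʳ (renL-↭⊆ ρ p (here refl)) (renL-↭⊆ ρ p))
      (sound ρ ρG d (dB ∷ dB ∷ dΔ) gF)
  sound ρ ρG (⊥-R d) dΔ _ = ⊨-⊥-R (sound ρ ρG d dΔ g⊥)
  sound ρ ρG (∧-L p d) dΔ′ gF with All-resp-↭ p dΔ′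
  ... | d∧ dB dD ∷ dΔ =
    ⊨-∧-L (renL-↭⊆ ρ p (here refl))
      (⊨-weaken (++⁺ʳ (_ ∷ _ ∷ []) (renL-↭⊆ ρ p))
        (sound ρ ρG d (dB ∷ dD ∷ d∧ dB dD ∷ dΔ) gF))
  sound ρ ρG (∧-R d e) dΔ (g∧ gB gD) = ⊨-∧-R (sound ρ ρG d dΔ gB) (sound ρ ρG e dΔ gD)
  sound ρ ρG (∨-R₁ d) dΔ (g∨ gB _) = ⊨-map ⊩-∨₁ (sound ρ ρG d dΔ gB)
  sound ρ ρG (∨-R₂ d) dΔ (g∨ _ gD) = ⊨-map ⊩-∨₂ (sound ρ ρG d dΔ gD)
  sound ρ ρG (⊃-L p d e) dΔ′ gF with All-resp-↭ p dΔ′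
  ... | d⊃ gB dD ∷ dΔ =
    ⊨-⊃-L (renL-↭⊆ ρ p (here refl))
      (⊨-weaken (renL-↭⊆ ρ p) (sound ρ ρG d (d⊃ gB dD ∷ dΔ) gB))
      (⊨-weaken (∷⁺ʳ _ (renL-↭⊆ ρ p ∘ there)) (sound ρ ρG e (dD ∷ dΔ) gF))
  sound ρ ρG (⊃-R d) dΔ (g⊃ dB gD) = ⊨-⊃-R (IsGF-renF ρ gD) (sound ρ ρG d (dB ∷ dΔ) gD)
  sound ρ ρG (∀-L {B = B} t p d) dΔ′ gF with All-resp-↭ p dΔ′
  ... | d∀ dB ∷ dΔ =
    ⊨-∀-L (renT ρ t) (renL-↭⊆ ρ p (here refl))
      (⊨-weaken (∷⁺ʳ _ (renL-↭⊆ ρ p))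
        (subst (λ B′ → B′ ∷ renL ρ (∀' B ∷ _) ⊨ _) (renF-substF ρ 0 t B)
          (sound ρ ρG d (IsDF-substF 0 t dB ∷ d∀ dB ∷ dΔ) gF)))
  sound ρ ρG (∃-R {B = B} t d) dΔ (g∃ gB) =
    ⊨-map (⊩-∃ (renT ρ t))
      (subst (_ ⊨_) (renF-substF ρ 0 t B) (sound ρ ρG d dΔ (IsGF-substF 0 t gB)))
  sound ρ ρG (∃-L {Δ} {B = B} c p (c∉Δ′ , c∉F , c∉G) d) dΔ′ gF with All-resp-↭ p dΔ′
  ... | d∃ dB ∷ dΔ =
    ⊨-∃-L (renL-↭⊆ ρ p (here refl)) λ c′ →
      ⊨-weaken (∷⁺ʳ _ (renL-↭⊆ ρ p ∘ there))
        (subst₂ _⊨_ (renL-upd-eigen B Δ (c∉Δ′ ∘ Any-resp-⊆ (⊆-reflexive-↭ (↭-sym p))))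
                    (renF-upd-fresh _ c∉F)
          (sound (upd ρ c c′) (trans (renF-upd-fresh G c∉G) ρG) d
                 (IsDF-substF 0 (const c) dB ∷ dΔ) gF))
  sound ρ ρG (∀-R _ _ _) _ ()
  sound ρ ρG (∨-L p d e) dΔ′ gF with All-resp-↭ p dΔ′
  ... | d∨ dB dD ∷ dΔ =
    ⊨-∨-L (renL-↭⊆ ρ p (here refl))
      (⊨-weaken (∷⁺ʳ _ (renL-↭⊆ ρ p ∘ there)) (sound ρ ρG d (dB ∷ dΔ) gF))
      (⊨-weaken (∷⁺ʳ _ (renL-↭⊆ ρ p ∘ there))
        (subst (_ ⊨_) ρG (sound ρ ρG e (dD ∷ dΔ) G-isGF)))
  sound ρ ρG (res d) dΔ _ = ⊨-res (subst (_ ⊨_) ρG (sound ρ ρG d dΔ G-isGF))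

lemma10 : (G : Fm) (Γ : List Fm) → IsGF G → All IsDF Γ →
    IG G Γ G → Σ (IG G Γ G) IsO
lemma10 G Γ G-isGF Γ-isDF d = □Explosive⇒⊢ₒG (⊨G⇒□Explosive Γ⊨G)
  where
  open Model G G-isGF
  Γ⊨G : Γ ⊨ G
  Γ⊨G = subst₂ _⊨_ (renL-id Γ) (renF-id G)
          (sound (λ c → c) (renF-id G) d Γ-isDF G-isGF)
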